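{- Let $\ell\ge 1$. Then (1) ${\blacktriangleright_\ell}\subseteq{\blacktriangleright_{\ell+1}}$; and (2) for all terms or sequences $a,b,c_1,c_2$, if $a\blacktriangleright_\ell b$ then $c_1 \mathbin{+\!\!+} a\mathbin{+\!\!+} c_2 \blacktriangleright_\ell c_1\mathbin{+\!\!+} b\mathbin{+\!\!+} c_2$.
   Context: $\mathcal F$ is a finite signature, $\mathcal V$ a set of variables, $\sqsupset$ a precedence (strict order) on $\mathcal F$. Sequences: using a fresh variadic symbol $\mathsf{list}$, a sequence is a term $[t_1\cdots t_k]=\mathsf{list}(t_1,\dots,t_k)$ with $t_i\in\mathcal T(\mathcal F,\mathcal V)$. Concatenation: $[s_1\cdots s_k]\mathbin{+\!\!+}[t_1\cdots t_l]=[s_1\cdots s_k\,t_1\cdots t_l]$, extended to terms by identifying a term $t$ with $[t]$. $\rhd$ denotes the strict superterm relation. Product extension $(a_i)_{i\le k}>^{\mathrm{prod}}(b_i)_{i\le k}$: $a_i=b_i$ or $a_i>b_i$ for all $i$, and $a_j>b_j$ for some $j$. For $\ell\ge1$, $a\blacktriangleright_\ell b$ holds for terms or sequences $a,b$ iff one of: (1) $a=f(s_1,\dots,s_k)$, $b=g(t_1,\dots,t_l)$, $f\sqsupset g$, $f(s_1,\dots,s_k)\rhd t_j$ for all $j$, and $l\le\ell$; (2) $a=f(s_1,\dots,s_k)$, $b=f(t_1,\dots,t_k)$ and $(s_1,\dots,s_k)\rhd^{\mathrm{prod}}(t_1,\dots,t_k)$; (3) $a=f(s_1,\dots,s_k)$,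 $b=[t_1\cdots t_l]$, $a\blacktriangleright_\ell t_j$ for all $j$, and $l\le\ell$; (4) $a=[s_1\cdots s_k]$, $b=[t_1\cdots t_l]$ and there are terms or sequences $b_1,\dots,b_k$ with $[t_1\cdots t_l]=b_1\mathbin{+\!\!+}\cdots\mathbin{+\!\!+}b_k$ and $(s_1,\dots,s_k)\blacktriangleright_\ell^{\mathrm{prod}}(b_1,\dots,b_k)$. (In (1)–(3), $f,g\in\mathcal F$.) -}

module Defs where

open import Level using (0ℓ)
open import Data.Nat using (ℕ; _≤_)
open import Data.Fin using (Fin)
open import Data.List using (List; []; _∷_; [_]; _++_; concat; map; length)
open import Data.List.Relation.Unary.All using (All)
open import Data.List.Relation.Binary.Pointwise using (Pointwise)
open import Data.Vec using (Vec; toList)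
import Data.Vec.Relation.Unary.All as VAll
open import Data.Vec.Membership.Propositional using (_∈_)
open import Data.Sum using (_⊎_)
open import Data.Product using (Σ; _×_)
open import Relation.Binary using (Rel; IsStrictPartialOrder)
open import Relation.Binary.PropositionalEquality using (_≡_)

record Sig : Set₁ where
  field
    n      : ℕ
    arity  : Fin n → ℕ
    _⊐_    : Rel (Fin n) 0ℓ
    isSPO  : IsStrictPartialOrder _≡_ _⊐_

-- Product extension of a relation R on lists of equal length:
-- pointwise (a ≡ b or R a b), and R at some position.
data ProdExt {A : Set} (R : A → A → Set) : List A → List A → Set where
  here  : ∀ {a b as bs} → R a b →
          Pointwise (λ x y → x ≡ y ⊎ R x y) as bs →
          ProdExt R (a ∷ as) (b ∷ bs)
  there : ∀ {a b as bs} → (a ≡ b ⊎ R a b) →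
          ProdExt R as bs → ProdExt R (a ∷ as) (b ∷ bs)

module TermsOver (Σs : Sig) (V : Set) where
  open Sig Σs

  data Term : Set where
    var : V → Term
    fun : (f : Fin n) → Vec Term (arity f) → Term

  data _▷_ : Term → Term → Set where
    arg  : ∀ {f ts u} → u ∈ ts → fun f ts ▷ u
    deep : ∀ {f ts u v} → u ∈ ts → u ▷ v → fun f ts ▷ v

  data TS : Set where
    tm : Term → TS
    sq : List Term → TS

  toSeq : TS → List Term
  toSeq (tm t) = [ t ]
  toSeq (sq ts) = ts

  _⧺_ : TS → TS → TS
  a ⧺ b = sq (toSeq a ++ toSeq b)

  infixr 5 _⧺_

  data ▶ (ℓ : ℕ) : TS → TS → Set where
    prec  : ∀ {f g ss ts} → f ⊐ g →
            VAll.All (λ t → fun f ss ▷ t) ts →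
            arity g ≤ ℓ →
            ▶ ℓ (tm (fun f ss)) (tm (fun g ts))
    sameF : ∀ {f ss ts} →
            ProdExt _▷_ (toList ss) (toList ts) →
            ▶ ℓ (tm (fun f ss)) (tm (fun f ts))
    toSq  : ∀ {f ss} {ts : List Term} →
            All (λ t → ▶ ℓ (tm (fun f ss)) (tm t)) ts →
            length ts ≤ ℓ →
            ▶ ℓ (tm (fun f ss)) (sq ts)
    seqs  : ∀ {ss ts : List Term} (bs : List TS) →
            concat (map toSeq bs) ≡ ts →
            ProdExt (▶ ℓ) (map tm ss) bs →
            ▶ ℓ (sq ss) (sq ts)

-- The bound ℓ occurs only as an upper bound on the
--     length of the right-hand side in rules (1) and (3); all other rules
--     just propagate ▶_ℓ to subderivations.  Hence ℓ ≤ ℓ′ gives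
--     ▶_ℓ ⊆ ▶_ℓ′, by one structural induction over derivations (written as a
--     mutual block so that the recursion through All, Pointwise and ProdExt
--     stays visibly structural).
--
-- First, every a ▶_ℓ b can be read as a
--     comparison of sequences [a] ▶_ℓ [b] (rule (4) with the one-block
--     decomposition [b]); a genuine sequence comparison is already of that
--     form.  Second, rule (4) is stable under adding a common prefix and
--     suffix: the decomposition is extended by the singleton blocks of the
--     context, and the product extension is unaffected by equal components
--     on either side.
module Submission where

open import Defs
open import Data.Nat using (ℕ; suc; _≤_)
open import Data.Nat.Properties using (≤-trans; n≤1+n)
open import Data.Product using (_×_; _,_)
open import Data.Sum using (_⊎_; inj₁; inj₂)
open import Data.List using (List; []; _∷_; [_]; _++_; concat; map)
open import Data.List.Relation.Unary.All using (All; []; _∷_)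
open import Data.List.Relation.Binary.Pointwise using (Pointwise; []; _∷_; ++⁺)
import Data.List.Relation.Binary.Pointwise.Properties as Pointwise
open import Data.List.Properties using (map-++; map-∘; concat-++; concat-map-[_]; ++-identityʳ)
open import Relation.Binary.PropositionalEquality
  using (_≡_; refl; sym; cong; cong₂; subst; module ≡-Reasoning)

module _ {A : Set} {R : A → A → Set} where

  ProdExt-++ʳ : ∀ {xs ys} zs → ProdExt R xs ys → ProdExt R (xs ++ zs) (ys ++ zs)
  ProdExt-++ʳ zs (here r rs)  = here r (++⁺ rs (Pointwise.refl (inj₁ refl)))
  ProdExt-++ʳ zs (there r rs) = there r (ProdExt-++ʳ zs rs)

  ProdExt-++ˡ : ∀ {xs ys} zs → ProdExt R xs ys → ProdExt R (zs ++ xs) (zs ++ ys)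
  ProdExt-++ˡ []       rs = rs
  ProdExt-++ˡ (z ∷ zs) rs = there (inj₁ refl) (ProdExt-++ˡ zs rs)

module Properties (Σs : Sig) (V : Set) where
  open TermsOver Σs V

  module Monotone {ℓ ℓ′ : ℕ} (ℓ≤ℓ′ : ℓ ≤ ℓ′) where
    mutual
      ▶-mono : ∀ {a b} → ▶ ℓ a b → ▶ ℓ′ a b
      ▶-mono (prec f⊐g sub ar≤ℓ) = prec f⊐g sub (≤-trans ar≤ℓ ℓ≤ℓ′)
      ▶-mono (sameF rs)          = sameF rs
      ▶-mono (toSq rs len≤ℓ)     = toSq (all-mono rs) (≤-trans len≤ℓ ℓ≤ℓ′)
      ▶-mono (seqs bs eq rs)     = seqs bs eq (prodExt-mono rs)

      all-mono : ∀ {a ts} → All (λ t → ▶ ℓ a (tm t)) ts → All (λ t → ▶ ℓ′ a (tm t)) ts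
      all-mono []       = []
      all-mono (r ∷ rs) = ▶-mono r ∷ all-mono rs

      prodExt-mono : ∀ {xs ys} → ProdExt (▶ ℓ) xs ys → ProdExt (▶ ℓ′) xs ys
      prodExt-mono (here r rs)  = here (▶-mono r) (pointwise-mono rs)
      prodExt-mono (there r rs) = there (reflexive-mono r) (prodExt-mono rs)

      pointwise-mono : ∀ {xs ys} → Pointwise (λ x y → x ≡ y ⊎ ▶ ℓ x y) xs ys
                     → Pointwise (λ x y → x ≡ y ⊎ ▶ ℓ′ x y) xs ys
      pointwise-mono []       = []
      pointwise-mono (r ∷ rs) = reflexive-mono r ∷ pointwise-mono rs

      reflexive-mono : ∀ {x y} → x ≡ y ⊎ ▶ ℓ x y → x ≡ y ⊎ ▶ ℓ′ x y
      reflexive-mono (inj₁ x≡y) = inj₁ x≡y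
      reflexive-mono (inj₂ r)   = inj₂ (▶-mono r)

  flatten-singletons : ∀ xs → concat (map toSeq (map tm xs)) ≡ xs
  flatten-singletons xs = begin
    concat (map toSeq (map tm xs)) ≡⟨ cong concat (sym (map-∘ xs)) ⟩
    concat (map [_] xs)            ≡⟨ concat-map-[ xs ] ⟩
    xs                             ∎
    where open ≡-Reasoning

  flatten-++ : ∀ bs cs → concat (map toSeq (bs ++ cs))
                       ≡ concat (map toSeq bs) ++ concat (map toSeq cs)
  flatten-++ bs cs = begin
    concat (map toSeq (bs ++ cs))                     ≡⟨ cong concat (map-++ toSeq bs cs) ⟩
    concat (map toSeq bs ++ map toSeq cs)             ≡⟨ sym (concat-++ (map toSeq bs) (map toSeq cs)) ⟩
    concat (map toSeq bs) ++ concat (map toSeq cs)    ∎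
    where open ≡-Reasoning

  module _ {ℓ : ℕ} where

    ▶-asSequences : ∀ {a b} → ▶ ℓ a b → ▶ ℓ (sq (toSeq a)) (sq (toSeq b))
    ▶-asSequences {tm _} {b} r = seqs [ b ] (++-identityʳ (toSeq b)) (here r [])
    ▶-asSequences r@(seqs _ _ _) = r

    ▶-framed : ∀ {xs ys} us vs → ▶ ℓ (sq xs) (sq ys)
             → ▶ ℓ (sq (us ++ xs ++ vs)) (sq (us ++ ys ++ vs))
    ▶-framed {xs} {ys} us vs (seqs bs flat≡ys rs) =
      seqs (map tm us ++ bs ++ map tm vs) flattened framedBlocks
      where
      open ≡-Reasoning

      flattened : concat (map toSeq (map tm us ++ bs ++ map tm vs)) ≡ us ++ ys ++ vs
      flattened = begin
        concat (map toSeq (map tm us ++ bs ++ map tm vs))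
          ≡⟨ flatten-++ (map tm us) (bs ++ map tm vs) ⟩
        concat (map toSeq (map tm us)) ++ concat (map toSeq (bs ++ map tm vs))
          ≡⟨ cong₂ _++_ (flatten-singletons us) (flatten-++ bs (map tm vs)) ⟩
        us ++ concat (map toSeq bs) ++ concat (map toSeq (map tm vs))
          ≡⟨ cong₂ (λ p q → us ++ p ++ q) flat≡ys (flatten-singletons vs) ⟩
        us ++ ys ++ vs ∎

      termsSplit : map tm (us ++ xs ++ vs) ≡ map tm us ++ map tm xs ++ map tm vs
      termsSplit = begin
        map tm (us ++ xs ++ vs)             ≡⟨ map-++ tm us (xs ++ vs) ⟩
        map tm us ++ map tm (xs ++ vs)      ≡⟨ cong (map tm us ++_) (map-++ tm xs vs) ⟩
        map tm us ++ map tm xs ++ map tm vs ∎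

      framedBlocks : ProdExt (▶ ℓ) (map tm (us ++ xs ++ vs)) (map tm us ++ bs ++ map tm vs)
      framedBlocks = subst (λ zs → ProdExt (▶ ℓ) zs _) (sym termsSplit)
                       (ProdExt-++ˡ (map tm us) (ProdExt-++ʳ (map tm vs) rs))

lemma2 : (Σs : Sig) (V : Set) (ℓ : ℕ) → 1 ≤ ℓ →
    let open TermsOver Σs V in
      (∀ {a b} → ▶ ℓ a b → ▶ (suc ℓ) a b) ×
      (∀ (a b c₁ c₂ : TS) → ▶ ℓ a b → ▶ ℓ (c₁ ⧺ a ⧺ c₂) (c₁ ⧺ b ⧺ c₂))
lemma2 Σs V ℓ _ = ▶-mono (n≤1+n ℓ) , inContext
  where
  open TermsOver Σs V
  open Properties Σs V
  open Monotone using (▶-mono)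

  inContext : ∀ a b c₁ c₂ → ▶ ℓ a b → ▶ ℓ (c₁ ⧺ a ⧺ c₂) (c₁ ⧺ b ⧺ c₂)
  inContext a b c₁ c₂ r = ▶-framed (toSeq c₁) (toSeq c₂) (▶-asSequences r)
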